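{- If $x$ is a prime, then $x^2+x+1$ is not a perfect cube. -}

module Defs where

-- Suppose x² + x + 1 = y³.  Then y ≥ 1; writing y = t + 1 and
-- Q(t) = t² + 3t + 3, the identity (t + 1)³ = 1 + t·Q(t) turns the equation
-- into  x(x + 1) = t·Q(t).  The prime x divides t or Q(t) (Euclid's lemma).
--
-- * If x ∣ t then x ≤ t (or t = 0, forcing x = 0), and then
--   x(x + 1) ≤ t(t + 1) < t·Q(t) since t + 1 < Q(t).
-- * If Q(t) = k·x then cancelling x gives x + 1 = t·k, whence
--   Q(t) + k = k(x + 1) = t·k².  This Diophantine equation has no solution:
--   if k² ≤ t + 3 the right side is too small; otherwise k² = t + 4 + r
--   forces t(1 + r) = 3 + k, hence k² ≤ 7 + k, so k ≤ 3 and t ≤ 6, and the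
--   remaining finitely many cases are checked by decision.
module Submission where

open import Defs
open import Data.Nat using (ℕ; _+_; _^_)
open import Data.Nat.Primality using (Prime)
open import Relation.Binary.PropositionalEquality using (_≢_)

open import Data.Nat using (zero; suc; _*_; _≤_; _<_; _≟_; z≤n; s≤s; z<s; NonZero; ≢-nonZero⁻¹)
open import Data.Nat.Properties
open import Data.Nat.Primality using (euclidsLemma; prime⇒nonZero)
open import Data.Nat.Divisibility using (_∣_; divides; ∣⇒≤)
open import Data.Nat.Tactic.RingSolver using (solve-∀)
open import Data.Fin using (Fin; toℕ; fromℕ<)
open import Data.Fin.Properties using (all?; toℕ-fromℕ<)
open import Data.Product using (_×_; _,_)
open import Data.Sum using (_⊎_; inj₁; inj₂)
open import Data.Empty using (⊥; ⊥-elim)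
open import Relation.Nullary.Decidable using (from-yes; ¬?)
open import Relation.Binary.PropositionalEquality
  using (_≡_; refl; sym; trans; cong; subst₂; module ≡-Reasoning)

cofactor : ℕ → ℕ
cofactor t = t * t + 3 * t + 3

suc-cube : ∀ t → (1 + t) ^ 3 ≡ 1 + t * cofactor t
suc-cube = expand
  where
  -- the ring solver does not see through _^_, so the powers are unfolded
  expand : ∀ t → (1 + t) * ((1 + t) * ((1 + t) * 1)) ≡ 1 + t * (t * t + 3 * t + 3)
  expand = solve-∀

square-plus : ∀ x → x ^ 2 + x + 1 ≡ 1 + x * (x + 1)
square-plus = expand
  where
  expand : ∀ x → x * (x * 1) + x + 1 ≡ 1 + x * (x + 1)
  expand = solve-∀

cofactor-large : ∀ t → t + 1 < cofactor t
cofactor-large t = ≤-trans (m≤m+n (suc (t + 1)) (t * t + 2 * t + 1)) (≤-reflexive (expand t))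
  where
  expand : ∀ t → suc (t + 1) + (t * t + 2 * t + 1) ≡ t * t + 3 * t + 3
  expand = solve-∀

square-bound : ∀ k → k * k ≤ 7 + k → k ≤ 3
square-bound 0 _ = z≤n
square-bound 1 _ = s≤s z≤n
square-bound 2 _ = s≤s (s≤s z≤n)
square-bound 3 _ = s≤s (s≤s (s≤s z≤n))
square-bound k@(suc (suc (suc (suc j)))) k²≤7+k =
  ⊥-elim (m+1+n≰m (7 + k) (≤-trans (≤-reflexive (expand j)) k²≤7+k))
  where
  expand : ∀ j → 7 + (4 + j) + suc (4 + 7 * j + j * j) ≡ (4 + j) * (4 + j)
  expand = solve-∀

small-cases : ∀ t k → t ≤ 6 → k ≤ 3 → cofactor t + k ≢ t * (k * k)
small-cases t k t≤6 k≤3 =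
  subst₂ (λ t k → cofactor t + k ≢ t * (k * k))
         (toℕ-fromℕ< (s≤s t≤6)) (toℕ-fromℕ< (s≤s k≤3))
         (checked (fromℕ< (s≤s t≤6)) (fromℕ< (s≤s k≤3)))
  where
  checked : ∀ (i : Fin 7) (j : Fin 4) →
            cofactor (toℕ i) + toℕ j ≢ toℕ i * (toℕ j * toℕ j)
  checked = from-yes (all? λ (i : Fin 7) → all? λ (j : Fin 4) →
    ¬? (cofactor (toℕ i) + toℕ j ≟ toℕ i * (toℕ j * toℕ j)))

small-square-side : ∀ t k → k * k ≤ t + 3 → t * (k * k) < cofactor t + k
small-square-side t k k²≤t+3 = begin-strict
  t * (k * k)              ≤⟨ *-monoʳ-≤ t k²≤t+3 ⟩
  t * (t + 3)              <⟨ m<m+n (t * (t + 3)) {3 + k} z<s ⟩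
  t * (t + 3) + (3 + k)    ≡⟨ expand t k ⟩
  cofactor t + k           ∎
  where
  open ≤-Reasoning
  expand : ∀ t k → t * (t + 3) + (3 + k) ≡ t * t + 3 * t + 3 + k
  expand = solve-∀

large-square-quotient : ∀ t k r → suc (t + 3) + r ≡ k * k →
                        cofactor t + k ≡ t * (k * k) → t * suc r ≡ 3 + k
large-square-quotient t k r k²≡ eq = +-cancelˡ-≡ (t * t + 3 * t) _ _ (begin
  (t * t + 3 * t) + t * suc r    ≡⟨ expand-right t r ⟩
  t * (suc (t + 3) + r)          ≡⟨ cong (t *_) k²≡ ⟩
  t * (k * k)                    ≡⟨ sym eq ⟩
  cofactor t + k                 ≡⟨ expand-left t k ⟩
  (t * t + 3 * t) + (3 + k)      ∎)
  where
  open ≡-Reasoning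
  expand-right : ∀ t r → (t * t + 3 * t) + t * suc r ≡ t * (suc (t + 3) + r)
  expand-right = solve-∀
  expand-left : ∀ t k → t * t + 3 * t + 3 + k ≡ (t * t + 3 * t) + (3 + k)
  expand-left = solve-∀

large-square-bounds : ∀ t k r .{{_ : NonZero t}} → suc (t + 3) + r ≡ k * k →
                      cofactor t + k ≡ t * (k * k) → t ≤ 6 × k ≤ 3
large-square-bounds t k r k²≡ eq = t≤6 , k≤3
  where
  quotient : t * suc r ≡ 3 + k
  quotient = large-square-quotient t k r k²≡ eq
  k²≤7+k : k * k ≤ 7 + k
  k²≤7+k = begin
    k * k                ≡⟨ sym k²≡ ⟩
    suc (t + 3) + r      ≤⟨ +-monoʳ-≤ (suc (t + 3)) (m≤n*m r t) ⟩
    suc (t + 3) + t * r  ≡⟨ regroup t r ⟩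
    4 + t * suc r        ≡⟨ cong (4 +_) quotient ⟩
    7 + k                ∎
    where
    open ≤-Reasoning
    regroup : ∀ t r → suc (t + 3) + t * r ≡ 4 + t * suc r
    regroup = solve-∀
  k≤3 : k ≤ 3
  k≤3 = square-bound k k²≤7+k
  t≤6 : t ≤ 6
  t≤6 = ≤-trans (m≤m*n t (suc r)) (≤-trans (≤-reflexive quotient) (+-monoʳ-≤ 3 k≤3))

no-cofactor-solution : ∀ t k → cofactor t + k ≢ t * (k * k)
no-cofactor-solution zero k ()
no-cofactor-solution t@(suc _) k eq with ≤-<-connex (k * k) (t + 3)
... | inj₁ k²≤t+3 = <⇒≢ (small-square-side t k k²≤t+3) (sym eq)
... | inj₂ t+3<k² with m≤n⇒∃[o]m+o≡n t+3<k²
...   | r , k²≡ with large-square-bounds t k r k²≡ eq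
...     | t≤6 , k≤3 = small-cases t k t≤6 k≤3 eq

divisor-of-root : ∀ x t → x ∣ t → x * (x + 1) ≡ t * cofactor t → x ≡ 0
divisor-of-root zero    _         _   _  = refl
divisor-of-root (suc x) zero      _   ()
divisor-of-root x       t@(suc _) x∣t eq = ⊥-elim (<⇒≢ lhs<rhs eq)
  where
  x≤t : x ≤ t
  x≤t = ∣⇒≤ x∣t
  lhs<rhs : x * (x + 1) < t * cofactor t
  lhs<rhs = begin-strict
    x * (x + 1)     ≤⟨ *-mono-≤ x≤t (+-monoˡ-≤ 1 x≤t) ⟩
    t * (t + 1)     <⟨ *-monoʳ-< t (cofactor-large t) ⟩
    t * cofactor t  ∎
    where open ≤-Reasoning

cofactor-quotient : ∀ x t k .{{_ : NonZero x}} → x * (x + 1) ≡ t * cofactor t →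
                    cofactor t ≡ k * x → cofactor t + k ≡ t * (k * k)
cofactor-quotient x t k eq Q≡kx = begin
  cofactor t + k   ≡⟨ cong (_+ k) Q≡kx ⟩
  k * x + k        ≡⟨ sym (*-suc-right k x) ⟩
  k * (x + 1)      ≡⟨ cong (k *_) x+1≡tk ⟩
  k * (t * k)      ≡⟨ rearrange k t ⟩
  t * (k * k)      ∎
  where
  open ≡-Reasoning
  *-suc-right : ∀ k x → k * (x + 1) ≡ k * x + k
  *-suc-right = solve-∀
  rearrange : ∀ k t → k * (t * k) ≡ t * (k * k)
  rearrange = solve-∀
  x+1≡tk : x + 1 ≡ t * k
  x+1≡tk = *-cancelˡ-≡ (x + 1) (t * k) x (begin
    x * (x + 1)      ≡⟨ eq ⟩
    t * cofactor t   ≡⟨ cong (t *_) Q≡kx ⟩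
    t * (k * x)      ≡⟨ rearrange′ t k x ⟩
    x * (t * k)      ∎)
    where
    rearrange′ : ∀ t k x → t * (k * x) ≡ x * (t * k)
    rearrange′ = solve-∀

cube-equation : ∀ x t → x ^ 2 + x + 1 ≡ suc t ^ 3 → x * (x + 1) ≡ t * cofactor t
cube-equation x t eq = suc-injective (begin
  1 + x * (x + 1)     ≡⟨ sym (square-plus x) ⟩
  x ^ 2 + x + 1       ≡⟨ eq ⟩
  suc t ^ 3           ≡⟨ suc-cube t ⟩
  1 + t * cofactor t  ∎)
  where open ≡-Reasoning

lemma14 : ∀ (x : ℕ) → Prime x → ∀ (y : ℕ) → x ^ 2 + x + 1 ≢ y ^ 3
lemma14 x px zero    eq = 1+n≢0 (trans (sym (square-plus x)) eq)
lemma14 x px (suc t) eq = by-cases (euclidsLemma t (cofactor t) px x∣tQ)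
  where
  instance
    x≢0 : NonZero x
    x≢0 = prime⇒nonZero px
  product : x * (x + 1) ≡ t * cofactor t
  product = cube-equation x t eq
  x∣tQ : x ∣ t * cofactor t
  x∣tQ = divides (x + 1) (trans (sym product) (*-comm x (x + 1)))
  by-cases : x ∣ t ⊎ x ∣ cofactor t → ⊥
  by-cases (inj₁ x∣t)             = ≢-nonZero⁻¹ x (divisor-of-root x t x∣t product)
  by-cases (inj₂ (divides k Q≡kx)) = no-cofactor-solution t k (cofactor-quotient x t k product Q≡kx)
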